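{- Let $h$ be a valuation of the formulas of the language $\{\vee,\wedge,\neg,\square\}$ in $\mathfrak M_{4m}$, and let a rule of $\mathbb T'$ have premise $\eta$ and alternative conclusion sets $\Upsilon_1,\dots,\Upsilon_n$. If $h$ satisfies $\eta$, then $h$ satisfies $\Upsilon_i$ for some $1\le i\le n$.
   Context: $\mathfrak M_{4m}$ is the lattice $M_4=\{\mathbf 0,\mathbf n,\mathbf b,\mathbf 1\}$ ($\mathbf 0<\mathbf n,\mathbf b<\mathbf 1$, $\mathbf n,\mathbf b$ incomparable) with $\neg\mathbf 0=\mathbf 1$, $\neg\mathbf 1=\mathbf 0$, $\neg\mathbf n=\mathbf n$, $\neg\mathbf b=\mathbf b$, $\square\mathbf 1=\mathbf 1$, $\square x=\mathbf 0$ for $x\ne\mathbf 1$. Formulas are built from propositional variables with $\vee,\wedge,\neg,\square$; a valuation is a homomorphism $h$ into $\mathfrak M_{4m}$. Signed formulas: $T(\alpha)$, $F(\alpha)$; $h$ satisfies $T(\alpha)$ iff $h(\alpha)\in\{\mathbf 1,\mathbf b\}$, $F(\alpha)$ iff $h(\alpha)\in\{\mathbf 0,\mathbf n\}$, and a set iff it satisfies each member. Rules of $\mathbb T'$ (premise $\Rightarrow$ conclusion sets separated by $|$): $T(\alpha\vee\beta)\Rightarrow\{T(\alpha)\}|\{T(\beta)\}$; $T(\neg(\alpha\vee\beta))\Rightarrow\{T(\neg\alpha),T(\neg\beta)\}$; $F(\alpha\vee\beta)\Rightarrow\{F(\alpha),F(\beta)\}$; $F(\neg(\alpha\vee\beta))\Rightarrow\{F(\neg\alpha)\}|\{F(\neg\beta)\}$;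 $T(\alpha\wedge\beta)\Rightarrow\{T(\alpha),T(\beta)\}$; $T(\neg(\alpha\wedge\beta))\Rightarrow\{T(\neg\alpha)\}|\{T(\neg\beta)\}$; $F(\alpha\wedge\beta)\Rightarrow\{F(\alpha)\}|\{F(\beta)\}$; $F(\neg(\alpha\wedge\beta))\Rightarrow\{F(\neg\alpha),F(\neg\beta)\}$; $T(\neg\neg\alpha)\Rightarrow\{T(\alpha)\}$; $F(\neg\neg\alpha)\Rightarrow\{F(\alpha)\}$; $T(\square\alpha)\Rightarrow\{T(\alpha),F(\neg\alpha)\}$; $F(\square\alpha)\Rightarrow\{F(\alpha)\}|\{T(\neg\alpha)\}$; $T(\neg\square\alpha)\Rightarrow\{F(\square\alpha)\}$; $F(\neg\square\alpha)\Rightarrow\{T(\square\alpha)\}$. -}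

module Defs where

open import Data.Nat using (ℕ)
open import Data.List using (List; []; _∷_)
open import Data.List.Relation.Unary.All using (All)
open import Data.List.Relation.Unary.Any using (Any)
open import Relation.Binary.PropositionalEquality using (_≡_)
open import Data.Sum using (_⊎_)

data M4 : Set where
  𝟎 𝐧 𝐛 𝟏 : M4

_∨ₘ_ : M4 → M4 → M4
𝟎 ∨ₘ y = y
𝟏 ∨ₘ y = 𝟏
𝐧 ∨ₘ 𝟎 = 𝐧
𝐧 ∨ₘ 𝐧 = 𝐧
𝐧 ∨ₘ 𝐛 = 𝟏
𝐧 ∨ₘ 𝟏 = 𝟏
𝐛 ∨ₘ 𝟎 = 𝐛
𝐛 ∨ₘ 𝐧 = 𝟏
𝐛 ∨ₘ 𝐛 = 𝐛
𝐛 ∨ₘ 𝟏 = 𝟏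

_∧ₘ_ : M4 → M4 → M4
𝟎 ∧ₘ y = 𝟎
𝟏 ∧ₘ y = y
𝐧 ∧ₘ 𝟎 = 𝟎
𝐧 ∧ₘ 𝐧 = 𝐧
𝐧 ∧ₘ 𝐛 = 𝟎
𝐧 ∧ₘ 𝟏 = 𝐧
𝐛 ∧ₘ 𝟎 = 𝟎
𝐛 ∧ₘ 𝐧 = 𝟎
𝐛 ∧ₘ 𝐛 = 𝐛
𝐛 ∧ₘ 𝟏 = 𝐛

¬ₘ_ : M4 → M4
¬ₘ 𝟎 = 𝟏
¬ₘ 𝐧 = 𝐧
¬ₘ 𝐛 = 𝐛
¬ₘ 𝟏 = 𝟎

□ₘ_ : M4 → M4
□ₘ 𝟏 = 𝟏
□ₘ _ = 𝟎

data Fm : Set where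
  var  : ℕ → Fm
  _∨'_ : Fm → Fm → Fm
  _∧'_ : Fm → Fm → Fm
  ¬'_  : Fm → Fm
  □'_  : Fm → Fm

-- A valuation is a homomorphism Fm → M4; it is determined by (and
-- here given as) its action on variables.
Assignment : Set
Assignment = ℕ → M4

⟦_⟧ : Fm → Assignment → M4
⟦ var i ⟧ v = v i
⟦ α ∨' β ⟧ v = ⟦ α ⟧ v ∨ₘ ⟦ β ⟧ v
⟦ α ∧' β ⟧ v = ⟦ α ⟧ v ∧ₘ ⟦ β ⟧ v
⟦ ¬' α ⟧ v = ¬ₘ ⟦ α ⟧ v
⟦ □' α ⟧ v = □ₘ ⟦ α ⟧ v

data Signed : Set where
  T F : Fm → Signed

Sat : Assignment → Signed → Set
Sat v (T α) = (⟦ α ⟧ v ≡ 𝟏) ⊎ (⟦ α ⟧ v ≡ 𝐛)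
Sat v (F α) = (⟦ α ⟧ v ≡ 𝟎) ⊎ (⟦ α ⟧ v ≡ 𝐧)

SatSet : Assignment → List Signed → Set
SatSet v Γ = All (Sat v) Γ

data Rule : Signed → List (List Signed) → Set where
  T∨  : ∀ α β → Rule (T (α ∨' β)) ((T α ∷ []) ∷ (T β ∷ []) ∷ [])
  T¬∨ : ∀ α β → Rule (T (¬' (α ∨' β))) ((T (¬' α) ∷ T (¬' β) ∷ []) ∷ [])
  F∨  : ∀ α β → Rule (F (α ∨' β)) ((F α ∷ F β ∷ []) ∷ [])
  F¬∨ : ∀ α β → Rule (F (¬' (α ∨' β))) ((F (¬' α) ∷ []) ∷ (F (¬' β) ∷ []) ∷ [])
  T∧  : ∀ α β → Rule (T (α ∧' β)) ((T α ∷ T β ∷ []) ∷ [])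
  T¬∧ : ∀ α β → Rule (T (¬' (α ∧' β))) ((T (¬' α) ∷ []) ∷ (T (¬' β) ∷ []) ∷ [])
  F∧  : ∀ α β → Rule (F (α ∧' β)) ((F α ∷ []) ∷ (F β ∷ []) ∷ [])
  F¬∧ : ∀ α β → Rule (F (¬' (α ∧' β))) ((F (¬' α) ∷ F (¬' β) ∷ []) ∷ [])
  T¬¬ : ∀ α → Rule (T (¬' (¬' α))) ((T α ∷ []) ∷ [])
  F¬¬ : ∀ α → Rule (F (¬' (¬' α))) ((F α ∷ []) ∷ [])
  T□  : ∀ α → Rule (T (□' α)) ((T α ∷ F (¬' α) ∷ []) ∷ [])
  F□  : ∀ α → Rule (F (□' α)) ((F α ∷ []) ∷ (T (¬' α) ∷ []) ∷ [])
  T¬□ : ∀ α → Rule (T (¬' (□' α))) ((F (□' α) ∷ []) ∷ [])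
  F¬□ : ∀ α → Rule (F (¬' (□' α))) ((T (□' α) ∷ []) ∷ [])

-- Satisfaction of a signed formula only depends on whether values are
-- designated, i.e. lie in the prime filter {𝟏, 𝐛} of M4.  Designation is a
-- lattice homomorphism M4 → Bool, ¬ₘ is a De Morgan involution, and □ₘ x is
-- designated iff x is designated and ¬ₘ x is not.  Hence the premise of every
-- rule of T' takes the same Boolean value as the disjunction, over its
-- conclusion sets, of the conjunction of their members: the rules are
-- invertible, and the theorem is one direction of this.

module Submission where

open import Defs
open import Data.Bool using (Bool; true; false; not; _∧_; _∨_) renaming (T to IsTrue)
open import Data.Bool.Properties using (∨-∧-booleanAlgebra)
open import Algebra.Lattice.Properties.BooleanAlgebra ∨-∧-booleanAlgebra
  using (deMorgan₁; deMorgan₂)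
open import Data.List using (List; []; _∷_)
open import Data.Bool.ListAction using (any; all)
open import Data.List.Relation.Unary.All as All using ()
open import Data.List.Relation.Unary.All.Properties using (all⁺)
open import Data.List.Relation.Unary.Any as Any using (Any)
open import Data.List.Relation.Unary.Any.Properties using (any⁻)
open import Data.Sum using (_⊎_; inj₁; inj₂)
open import Function using (_∘_)
open import Relation.Binary.PropositionalEquality
  using (_≡_; refl; sym; trans; cong; cong₂; subst; module ≡-Reasoning)

¬ₘ-involutive : ∀ x → ¬ₘ (¬ₘ x) ≡ x
¬ₘ-involutive 𝟎 = refl
¬ₘ-involutive 𝐧 = refl
¬ₘ-involutive 𝐛 = refl
¬ₘ-involutive 𝟏 = refl

¬ₘ-distrib-∨ₘ : ∀ x y → ¬ₘ (x ∨ₘ y) ≡ (¬ₘ x) ∧ₘ (¬ₘ y)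
¬ₘ-distrib-∨ₘ 𝟎 y = refl
¬ₘ-distrib-∨ₘ 𝟏 y = refl
¬ₘ-distrib-∨ₘ 𝐧 𝟎 = refl
¬ₘ-distrib-∨ₘ 𝐧 𝐧 = refl
¬ₘ-distrib-∨ₘ 𝐧 𝐛 = refl
¬ₘ-distrib-∨ₘ 𝐧 𝟏 = refl
¬ₘ-distrib-∨ₘ 𝐛 𝟎 = refl
¬ₘ-distrib-∨ₘ 𝐛 𝐧 = refl
¬ₘ-distrib-∨ₘ 𝐛 𝐛 = refl
¬ₘ-distrib-∨ₘ 𝐛 𝟏 = refl

¬ₘ-distrib-∧ₘ : ∀ x y → ¬ₘ (x ∧ₘ y) ≡ (¬ₘ x) ∨ₘ (¬ₘ y)
¬ₘ-distrib-∧ₘ x y = begin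
  ¬ₘ (x ∧ₘ y)                           ≡⟨ cong ¬ₘ_ (cong₂ _∧ₘ_ (¬ₘ-involutive x) (¬ₘ-involutive y)) ⟨
  ¬ₘ ((¬ₘ (¬ₘ x)) ∧ₘ (¬ₘ (¬ₘ y)))       ≡⟨ cong ¬ₘ_ (¬ₘ-distrib-∨ₘ (¬ₘ x) (¬ₘ y)) ⟨
  ¬ₘ (¬ₘ ((¬ₘ x) ∨ₘ (¬ₘ y)))            ≡⟨ ¬ₘ-involutive ((¬ₘ x) ∨ₘ (¬ₘ y)) ⟩
  (¬ₘ x) ∨ₘ (¬ₘ y)                      ∎
  where open ≡-Reasoning

designated : M4 → Bool
designated 𝟏 = true
designated 𝐛 = true
designated 𝟎 = false
designated 𝐧 = false

undesignated : M4 → Bool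
undesignated x = not (designated x)

designated⁺ : ∀ {x} → (x ≡ 𝟏) ⊎ (x ≡ 𝐛) → IsTrue (designated x)
designated⁺ (inj₁ refl) = _
designated⁺ (inj₂ refl) = _

designated⁻ : ∀ x → IsTrue (designated x) → (x ≡ 𝟏) ⊎ (x ≡ 𝐛)
designated⁻ 𝟏 _ = inj₁ refl
designated⁻ 𝐛 _ = inj₂ refl

undesignated⁺ : ∀ {x} → (x ≡ 𝟎) ⊎ (x ≡ 𝐧) → IsTrue (undesignated x)
undesignated⁺ (inj₁ refl) = _
undesignated⁺ (inj₂ refl) = _

undesignated⁻ : ∀ x → IsTrue (undesignated x) → (x ≡ 𝟎) ⊎ (x ≡ 𝐧)
undesignated⁻ 𝟎 _ = inj₁ refl
undesignated⁻ 𝐧 _ = inj₂ refl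

designated-∨ₘ : ∀ x y → designated (x ∨ₘ y) ≡ designated x ∨ designated y
designated-∨ₘ 𝟎 y = refl
designated-∨ₘ 𝟏 y = refl
designated-∨ₘ 𝐧 𝟎 = refl
designated-∨ₘ 𝐧 𝐧 = refl
designated-∨ₘ 𝐧 𝐛 = refl
designated-∨ₘ 𝐧 𝟏 = refl
designated-∨ₘ 𝐛 𝟎 = refl
designated-∨ₘ 𝐛 𝐧 = refl
designated-∨ₘ 𝐛 𝐛 = refl
designated-∨ₘ 𝐛 𝟏 = refl

designated-∧ₘ : ∀ x y → designated (x ∧ₘ y) ≡ designated x ∧ designated y
designated-∧ₘ 𝟎 y = refl
designated-∧ₘ 𝟏 y = refl
designated-∧ₘ 𝐧 𝟎 = refl
designated-∧ₘ 𝐧 𝐧 = refl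
designated-∧ₘ 𝐧 𝐛 = refl
designated-∧ₘ 𝐧 𝟏 = refl
designated-∧ₘ 𝐛 𝟎 = refl
designated-∧ₘ 𝐛 𝐧 = refl
designated-∧ₘ 𝐛 𝐛 = refl
designated-∧ₘ 𝐛 𝟏 = refl

designated-¬ₘ-∨ₘ : ∀ x y → designated (¬ₘ (x ∨ₘ y)) ≡ designated (¬ₘ x) ∧ designated (¬ₘ y)
designated-¬ₘ-∨ₘ x y = trans (cong designated (¬ₘ-distrib-∨ₘ x y)) (designated-∧ₘ (¬ₘ x) (¬ₘ y))

designated-¬ₘ-∧ₘ : ∀ x y → designated (¬ₘ (x ∧ₘ y)) ≡ designated (¬ₘ x) ∨ designated (¬ₘ y)
designated-¬ₘ-∧ₘ x y = trans (cong designated (¬ₘ-distrib-∧ₘ x y)) (designated-∨ₘ (¬ₘ x) (¬ₘ y))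

designated-□ₘ : ∀ x → designated (□ₘ x) ≡ designated x ∧ undesignated (¬ₘ x)
designated-□ₘ 𝟎 = refl
designated-□ₘ 𝐧 = refl
designated-□ₘ 𝐛 = refl
designated-□ₘ 𝟏 = refl

designated-¬ₘ-□ₘ : ∀ x → designated (¬ₘ (□ₘ x)) ≡ undesignated (□ₘ x)
designated-¬ₘ-□ₘ 𝟏 = refl
designated-¬ₘ-□ₘ 𝟎 = refl
designated-¬ₘ-□ₘ 𝐧 = refl
designated-¬ₘ-□ₘ 𝐛 = refl

undesignated-∨ₘ : ∀ x y → undesignated (x ∨ₘ y) ≡ undesignated x ∧ undesignated y
undesignated-∨ₘ x y =
  trans (cong not (designated-∨ₘ x y)) (deMorgan₂ (designated x) (designated y))

undesignated-∧ₘ : ∀ x y → undesignated (x ∧ₘ y) ≡ undesignated x ∨ undesignated y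
undesignated-∧ₘ x y =
  trans (cong not (designated-∧ₘ x y)) (deMorgan₁ (designated x) (designated y))

undesignated-¬ₘ-∨ₘ : ∀ x y → undesignated (¬ₘ (x ∨ₘ y)) ≡ undesignated (¬ₘ x) ∨ undesignated (¬ₘ y)
undesignated-¬ₘ-∨ₘ x y =
  trans (cong not (designated-¬ₘ-∨ₘ x y)) (deMorgan₁ (designated (¬ₘ x)) (designated (¬ₘ y)))

undesignated-¬ₘ-∧ₘ : ∀ x y → undesignated (¬ₘ (x ∧ₘ y)) ≡ undesignated (¬ₘ x) ∧ undesignated (¬ₘ y)
undesignated-¬ₘ-∧ₘ x y =
  trans (cong not (designated-¬ₘ-∧ₘ x y)) (deMorgan₂ (designated (¬ₘ x)) (designated (¬ₘ y)))

undesignated-□ₘ : ∀ x → undesignated (□ₘ x) ≡ undesignated x ∨ designated (¬ₘ x)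
undesignated-□ₘ 𝟎 = refl
undesignated-□ₘ 𝐧 = refl
undesignated-□ₘ 𝐛 = refl
undesignated-□ₘ 𝟏 = refl

undesignated-¬ₘ-□ₘ : ∀ x → undesignated (¬ₘ (□ₘ x)) ≡ designated (□ₘ x)
undesignated-¬ₘ-□ₘ 𝟏 = refl
undesignated-¬ₘ-□ₘ 𝟎 = refl
undesignated-¬ₘ-□ₘ 𝐧 = refl
undesignated-¬ₘ-□ₘ 𝐛 = refl

holds : Assignment → Signed → Bool
holds v (T α) = designated (⟦ α ⟧ v)
holds v (F α) = undesignated (⟦ α ⟧ v)

Sat⇒holds : ∀ v s → Sat v s → IsTrue (holds v s)
Sat⇒holds v (T α) = designated⁺
Sat⇒holds v (F α) = undesignated⁺

holds⇒Sat : ∀ v s → IsTrue (holds v s) → Sat v s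
holds⇒Sat v (T α) = designated⁻ (⟦ α ⟧ v)
holds⇒Sat v (F α) = undesignated⁻ (⟦ α ⟧ v)

module _ {A : Set} (p : A → Bool) where

  any-all-single : ∀ x → any (all p) ((x ∷ []) ∷ []) ≡ p x
  any-all-single x with p x
  ... | true  = refl
  ... | false = refl

  any-all-pair : ∀ x y → any (all p) ((x ∷ y ∷ []) ∷ []) ≡ p x ∧ p y
  any-all-pair x y with p x | p y
  ... | true  | true  = refl
  ... | true  | false = refl
  ... | false | _     = refl

  any-all-choice : ∀ x y → any (all p) ((x ∷ []) ∷ (y ∷ []) ∷ []) ≡ p x ∨ p y
  any-all-choice x y with p x | p y
  ... | true  | _     = refl
  ... | false | true  = refl
  ... | false | false = refl

rule-invertible : ∀ v {η Υs} → Rule η Υs → holds v η ≡ any (all (holds v)) Υs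
rule-invertible v (T∨ α β) =
  trans (designated-∨ₘ (⟦ α ⟧ v) (⟦ β ⟧ v)) (sym (any-all-choice (holds v) (T α) (T β)))
rule-invertible v (T¬∨ α β) =
  trans (designated-¬ₘ-∨ₘ (⟦ α ⟧ v) (⟦ β ⟧ v)) (sym (any-all-pair (holds v) (T (¬' α)) (T (¬' β))))
rule-invertible v (F∨ α β) =
  trans (undesignated-∨ₘ (⟦ α ⟧ v) (⟦ β ⟧ v)) (sym (any-all-pair (holds v) (F α) (F β)))
rule-invertible v (F¬∨ α β) =
  trans (undesignated-¬ₘ-∨ₘ (⟦ α ⟧ v) (⟦ β ⟧ v)) (sym (any-all-choice (holds v) (F (¬' α)) (F (¬' β))))
rule-invertible v (T∧ α β) =
  trans (designated-∧ₘ (⟦ α ⟧ v) (⟦ β ⟧ v)) (sym (any-all-pair (holds v) (T α) (T β)))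
rule-invertible v (T¬∧ α β) =
  trans (designated-¬ₘ-∧ₘ (⟦ α ⟧ v) (⟦ β ⟧ v)) (sym (any-all-choice (holds v) (T (¬' α)) (T (¬' β))))
rule-invertible v (F∧ α β) =
  trans (undesignated-∧ₘ (⟦ α ⟧ v) (⟦ β ⟧ v)) (sym (any-all-choice (holds v) (F α) (F β)))
rule-invertible v (F¬∧ α β) =
  trans (undesignated-¬ₘ-∧ₘ (⟦ α ⟧ v) (⟦ β ⟧ v)) (sym (any-all-pair (holds v) (F (¬' α)) (F (¬' β))))
rule-invertible v (T¬¬ α) =
  trans (cong designated (¬ₘ-involutive (⟦ α ⟧ v))) (sym (any-all-single (holds v) (T α)))
rule-invertible v (F¬¬ α) =
  trans (cong undesignated (¬ₘ-involutive (⟦ α ⟧ v))) (sym (any-all-single (holds v) (F α)))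
rule-invertible v (T□ α) =
  trans (designated-□ₘ (⟦ α ⟧ v)) (sym (any-all-pair (holds v) (T α) (F (¬' α))))
rule-invertible v (F□ α) =
  trans (undesignated-□ₘ (⟦ α ⟧ v)) (sym (any-all-choice (holds v) (F α) (T (¬' α))))
rule-invertible v (T¬□ α) =
  trans (designated-¬ₘ-□ₘ (⟦ α ⟧ v)) (sym (any-all-single (holds v) (F (□' α))))
rule-invertible v (F¬□ α) =
  trans (undesignated-¬ₘ-□ₘ (⟦ α ⟧ v)) (sym (any-all-single (holds v) (T (□' α))))

lemma6p2 : (h : Assignment) (η : Signed) (Υs : List (List Signed)) →
    Rule η Υs → Sat h η → Any (SatSet h) Υs
lemma6p2 h η Υs rule sat =
  Any.map (All.map (holds⇒Sat h _) ∘ all⁺ (holds h) _)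
    (any⁻ (all (holds h)) Υs (subst IsTrue (rule-invertible h rule) (Sat⇒holds h η sat)))
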